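{- Let $\Gamma$ be a finitely generated abelian group, $E$ a finite list of elements of $\Gamma$, $r(A)=\operatorname{rank}\langle A\rangle$ for $A\subseteq E$, $m:2^E\to\mathbb{R}$ any function, and $\mathcal{M}=(E,r,m)$. For $A\subseteq E$ let $$\chi_{\mathcal{M}/A}(s)=\sum_{B\subseteq E\setminus A}(-1)^{|B|}m(A\cup B)s^{r(\Gamma)-r(A\cup B)},$$ where $r(\Gamma)=\operatorname{rank}\Gamma$. Then for $p_e\in[0,1]$, $$\mathbb{E}\bigl[\chi_{\mathcal{M}/E_{\underline p}}(s)\bigr]=s^{r(\Gamma)}\prod_{e\in E}(1-p_e)\;\mathbf{Z}_{\mathcal{M}}\Bigl(s,\bigl(\tfrac{2p_e-1}{1-p_e}\bigr)_{e\in E}\Bigr).$$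
   Context: $\langle A\rangle$ is the subgroup generated by $A$. $\chi_{\mathcal{M}/A}$ is the chromatic polynomial of the contraction, viewed as represented by the cosets of $E\setminus A$ in $\Gamma/\langle A\rangle$. $\mathbf{Z}_{\mathcal{M}}(q,(v_e))=\sum_{A\subseteq E}m(A)q^{ -r(A)}\prod_{e\in A}v_e$; the right-hand side is understood as the polynomial $s^{r(\Gamma)}\sum_{A\subseteq E}m(A)s^{ -r(A)}\prod_{e\in A}(2p_e-1)\prod_{e\in E\setminus A}(1-p_e)$. $E_{\underline p}$ is the random sublist containing each $e$ independently with probability $p_e$. -}

module Defs where

open import Level using (Level; _⊔_)
open import Data.Nat using (ℕ; zero; suc; _∸_)
open import Data.Integer using (ℤ; +_; -[1+_])
open import Data.Fin using (Fin)
open import Data.Fin.Subset using (Subset; inside; outside; _∈_; ∣_∣; _∪_; ∁)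
open import Data.Vec using (Vec; []; _∷_; lookup)
open import Data.List using (List; []; _∷_; map; _++_)
open import Data.Product using (Σ; _×_)
open import Relation.Binary.PropositionalEquality using (_≡_)
open import Relation.Nullary using (¬_)
open import Algebra.Bundles using (AbelianGroup; CommutativeRing)

-- Subsets of the index set Fin n of the list E = (e_0,…,e_{n-1})

subsetsOf : ∀ {n} → Subset n → List (Subset n)
subsetsOf {zero} [] = [] ∷ []
subsetsOf {suc n} (outside ∷ A) = map (outside ∷_) (subsetsOf A)
subsetsOf {suc n} (inside ∷ A) =
  map (outside ∷_) (subsetsOf A) ++ map (inside ∷_) (subsetsOf A)

allSubsets : ∀ n → List (Subset n)
allSubsets n = subsetsOf {n} Data.Fin.Subset.⊤

module GroupRank {c ℓ} (G : AbelianGroup c ℓ) where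
  open AbelianGroup G

  natMul : ℕ → Carrier → Carrier
  natMul zero x = ε
  natMul (suc k) x = x ∙ natMul k x

  zMul : ℤ → Carrier → Carrier
  zMul (+ k) x = natMul k x
  zMul -[1+ k ] x = (natMul (suc k) x) ⁻¹

  lin : ∀ {k} → (Fin k → ℤ) → Vec Carrier k → Carrier
  lin c [] = ε
  lin c (x ∷ xs) = zMul (c Data.Fin.zero) x ∙ lin (λ i → c (Data.Fin.suc i)) xs

  linOn : ∀ {k} → Subset k → (Fin k → ℤ) → Vec Carrier k → Carrier
  linOn [] c [] = ε
  linOn (outside ∷ A) c (x ∷ xs) = linOn A (λ i → c (Data.Fin.suc i)) xs
  linOn (inside ∷ A) c (x ∷ xs) =
    zMul (c Data.Fin.zero) x ∙ linOn A (λ i → c (Data.Fin.suc i)) xs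

  FinitelyGenerated : Set (c ⊔ ℓ)
  FinitelyGenerated =
    Σ ℕ λ k → Σ (Vec Carrier k) λ gs → ∀ x → Σ (Fin k → ℤ) λ co → x ≈ lin co gs

  InSpan : ∀ {n} → Vec Carrier n → Subset n → Carrier → Set ℓ
  InSpan E A x = Σ (Fin _ → ℤ) λ co → x ≈ linOn A co E

  Independent : ∀ {k} → Vec Carrier k → Set ℓ
  Independent {k} xs = ∀ (co : Fin k → ℤ) → lin co xs ≈ ε → ∀ i → co i ≡ + 0

  AllIn : ∀ {k} {p} → (Carrier → Set p) → Vec Carrier k → Set p
  AllIn {k} H xs = ∀ (i : Fin k) → H (lookup xs i)

  HasRank : ∀ {p} → (Carrier → Set p) → ℕ → Set (c ⊔ ℓ ⊔ p)
  HasRank H r =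
    (Σ (Vec Carrier r) λ xs → AllIn H xs × Independent xs)
    × (∀ (ys : Vec Carrier (suc r)) → AllIn H ys → ¬ Independent ys)

module RingOps {c ℓ} (R : CommutativeRing c ℓ) where
  open CommutativeRing R

  pow : Carrier → ℕ → Carrier
  pow x zero = 1#
  pow x (suc k) = x * pow x k

  sumL : ∀ {a} {X : Set a} → List X → (X → Carrier) → Carrier
  sumL [] f = 0#
  sumL (x ∷ xs) f = f x + sumL xs f

  prodIn : ∀ {n} → Subset n → (Fin n → Carrier) → Carrier
  prodIn [] f = 1#
  prodIn (outside ∷ A) f = prodIn A (λ i → f (Data.Fin.suc i))
  prodIn (inside ∷ A) f = f Data.Fin.zero * prodIn A (λ i → f (Data.Fin.suc i))

  -- probability that the random sublist E_p equals A
  probOf : ∀ {n} → (Fin n → Carrier) → Subset n → Carrier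
  probOf p A = prodIn A p * prodIn (∁ A) (λ e → 1# - p e)

  expect : ∀ {n} → (Fin n → Carrier) → (Subset n → Carrier) → Carrier
  expect {n} p f = sumL (allSubsets n) (λ A → probOf p A * f A)

  chiContr : ∀ {n} → (Subset n → ℕ) → ℕ → (Subset n → Carrier) →
             Carrier → Subset n → Carrier
  chiContr r rΓ m s A =
    sumL (subsetsOf (∁ A)) (λ B →
      pow (- 1#) ∣ B ∣ * m (A ∪ B) * pow s (rΓ ∸ r (A ∪ B)))

  -- s^{r(Γ)} Π(1-p_e) Z_M(s, ((2p_e-1)/(1-p_e))), understood as the polynomial
  -- s^{r(Γ)} Σ_A m(A) s^{-r(A)} Π_{e∈A}(2p_e-1) Π_{e∉A}(1-p_e)
  rhsZ : ∀ {n} → (Subset n → ℕ) → ℕ → (Subset n → Carrier) →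
         (Fin n → Carrier) → Carrier → Carrier
  rhsZ {n} r rΓ m p s =
    sumL (allSubsets n) (λ A →
      m A * pow s (rΓ ∸ r A)
        * prodIn A (λ e → (p e + p e) - 1#)
        * prodIn (∁ A) (λ e → 1# - p e))

module Submission where

-- The corollary is an identity between polynomials in s with coefficients
-- in an arbitrary commutative ring, and it holds for every function
-- f : 2^E → R in place of A ↦ m(A) s^{r(Γ) - r(A)}.

open import Defs
open import Data.Nat using (ℕ; zero; suc; _∸_)
open import Data.Fin using (Fin)
open import Data.Fin.Subset using (Subset; inside; outside; ∣_∣; _∪_; ∁; ⊤)
open import Data.Vec using (Vec; []; _∷_)
open import Data.List using (List; []; _∷_; map; _++_)
open import Algebra.Bundles using (AbelianGroup; CommutativeRing)
import Relation.Binary.Reasoning.Setoid as SetoidReasoning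
import Algebra.Solver.CommutativeMonoid as CommutativeMonoidSolver
import Algebra.Properties.Ring as RingProperties
import Algebra.Properties.AbelianGroup as AbelianGroupProperties
import Data.Unit.Polymorphic
import Level

module SubsetExpectation {c ℓ} (R : CommutativeRing c ℓ) where
  open CommutativeRing R
  open RingOps R
  open SetoidReasoning setoid
  open RingProperties ring using (-1*x≈-x; x[y-z]≈xy-xz; [y-z]x≈yx-zx)
  open AbelianGroupProperties +-abelianGroup using (⁻¹-anti-homo‿-)
  module ×-Solver = CommutativeMonoidSolver *-commutativeMonoid
  open ×-Solver using (_⊕_; _⊜_)

  sumL-++ : ∀ {a} {X : Set a} (xs ys : List X) (f : X → Carrier) →
            sumL (xs ++ ys) f ≈ sumL xs f + sumL ys f
  sumL-++ [] ys f = sym (+-identityˡ _)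
  sumL-++ (x ∷ xs) ys f = trans (+-congˡ (sumL-++ xs ys f)) (sym (+-assoc _ _ _))

  sumL-map : ∀ {a b} {X : Set a} {Y : Set b} (g : X → Y) (xs : List X) (f : Y → Carrier) →
             sumL (map g xs) f ≈ sumL xs (λ x → f (g x))
  sumL-map g [] f = refl
  sumL-map g (x ∷ xs) f = +-congˡ (sumL-map g xs f)

  sumL-cong : ∀ {a} {X : Set a} (xs : List X) {f g : X → Carrier} →
              (∀ x → f x ≈ g x) → sumL xs f ≈ sumL xs g
  sumL-cong [] f≈g = refl
  sumL-cong (x ∷ xs) f≈g = +-cong (f≈g x) (sumL-cong xs f≈g)

  sumL-+ : ∀ {a} {X : Set a} (xs : List X) (f g : X → Carrier) →
           sumL xs (λ x → f x + g x) ≈ sumL xs f + sumL xs g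
  sumL-+ [] f g = sym (+-identityˡ _)
  sumL-+ (x ∷ xs) f g = trans (+-congˡ (sumL-+ xs f g)) (interchange (f x) (g x) _ _)
    where
    module +-Solver = CommutativeMonoidSolver +-commutativeMonoid
    interchange : ∀ a b c d → (a + b) + (c + d) ≈ (a + c) + (b + d)
    interchange = +-Solver.solve 4
      (λ a b c d → (a +-Solver.⊕ b) +-Solver.⊕ (c +-Solver.⊕ d)
                   +-Solver.⊜ (a +-Solver.⊕ c) +-Solver.⊕ (b +-Solver.⊕ d)) refl

  sumL-*ˡ : ∀ {a} {X : Set a} (xs : List X) (k : Carrier) (f : X → Carrier) →
            sumL xs (λ x → k * f x) ≈ k * sumL xs f
  sumL-*ˡ [] k f = sym (zeroʳ k)
  sumL-*ˡ (x ∷ xs) k f = trans (+-congˡ (sumL-*ˡ xs k f)) (sym (distribˡ k _ _))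

  sumL-neg : ∀ {a} {X : Set a} (xs : List X) (f : X → Carrier) →
             sumL xs (λ x → - f x) ≈ - sumL xs f
  sumL-neg xs f = begin
    sumL xs (λ x → - f x)      ≈⟨ sumL-cong xs (λ x → sym (-1*x≈-x (f x))) ⟩
    sumL xs (λ x → - 1# * f x) ≈⟨ sumL-*ˡ xs (- 1#) f ⟩
    - 1# * sumL xs f           ≈⟨ -1*x≈-x _ ⟩
    - sumL xs f                ∎

  sumL-subsetsOf-inside : ∀ {n} (X : Subset n) (g : Subset (suc n) → Carrier) →
    sumL (subsetsOf (inside ∷ X)) g
      ≈ sumL (subsetsOf X) (λ B → g (outside ∷ B)) + sumL (subsetsOf X) (λ B → g (inside ∷ B))
  sumL-subsetsOf-inside X g = begin
    sumL (map (outside ∷_) S ++ map (inside ∷_) S) g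
      ≈⟨ sumL-++ (map (outside ∷_) S) (map (inside ∷_) S) g ⟩
    sumL (map (outside ∷_) S) g + sumL (map (inside ∷_) S) g
      ≈⟨ +-cong (sumL-map (outside ∷_) S g) (sumL-map (inside ∷_) S g) ⟩
    sumL S (λ B → g (outside ∷ B)) + sumL S (λ B → g (inside ∷ B)) ∎
    where
    S : List (Subset _)
    S = subsetsOf X

  contraction : ∀ {n} → (Subset n → Carrier) → Subset n → Carrier
  contraction f A = sumL (subsetsOf (∁ A)) (λ B → pow (- 1#) ∣ B ∣ * f (A ∪ B))

  zSum : ∀ {n} → (Fin n → Carrier) → (Subset n → Carrier) → Carrier
  zSum {n} p f = sumL (allSubsets n) (λ C →
    f C * prodIn C (λ e → (p e + p e) - 1#) * prodIn (∁ C) (λ e → 1# - p e))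

  without₀ with₀ : ∀ {n} → (Subset (suc n) → Carrier) → Subset n → Carrier
  without₀ f A = f (outside ∷ A)
  with₀ f A = f (inside ∷ A)

  -- Removing e₀ from A: B ranges over sets with and without e₀, and those
  -- containing e₀ carry an extra sign.
  contraction-outside : ∀ {n} (f : Subset (suc n) → Carrier) (A : Subset n) →
    contraction f (outside ∷ A) ≈ contraction (without₀ f) A - contraction (with₀ f) A
  contraction-outside f A = begin
    contraction f (outside ∷ A)
      ≈⟨ sumL-subsetsOf-inside (∁ A) (λ B → pow (- 1#) ∣ B ∣ * f ((outside ∷ A) ∪ B)) ⟩
    contraction (without₀ f) A + sumL S (λ B → (- 1# * pow (- 1#) ∣ B ∣) * with₀ f (A ∪ B))
      ≈⟨ +-congˡ (sumL-cong S (λ B → *-assoc _ _ _)) ⟩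
    contraction (without₀ f) A + sumL S (λ B → - 1# * (pow (- 1#) ∣ B ∣ * with₀ f (A ∪ B)))
      ≈⟨ +-congˡ (trans (sumL-*ˡ S (- 1#) _) (-1*x≈-x _)) ⟩
    contraction (without₀ f) A - contraction (with₀ f) A ∎
    where
    S : List (Subset _)
    S = subsetsOf (∁ A)

  -- If e₀ ∈ A, every A ∪ B contains e₀.
  contraction-inside : ∀ {n} (f : Subset (suc n) → Carrier) (A : Subset n) →
    contraction f (inside ∷ A) ≈ contraction (with₀ f) A
  contraction-inside f A = sumL-map (outside ∷_) (subsetsOf (∁ A)) _

  expect-cong : ∀ {n} (p : Fin n → Carrier) {g h : Subset n → Carrier} →
                (∀ A → g A ≈ h A) → expect p g ≈ expect p h
  expect-cong {n} p g≈h = sumL-cong (allSubsets n) (λ A → *-congˡ (g≈h A))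

  expect-sub : ∀ {n} (p : Fin n → Carrier) (g h : Subset n → Carrier) →
               expect p (λ A → g A - h A) ≈ expect p g - expect p h
  expect-sub {n} p g h = begin
    sumL S (λ A → probOf p A * (g A - h A))
      ≈⟨ sumL-cong S (λ A → x[y-z]≈xy-xz (probOf p A) (g A) (h A)) ⟩
    sumL S (λ A → probOf p A * g A - probOf p A * h A)
      ≈⟨ trans (sumL-+ S _ _) (+-congˡ (sumL-neg S _)) ⟩
    expect p g - expect p h ∎
    where
    S : List (Subset n)
    S = allSubsets n

  pull-left : ∀ k x y z → ((k * x) * y) * z ≈ k * ((x * y) * z)
  pull-left = ×-Solver.solve 4 (λ k x y z → ((k ⊕ x) ⊕ y) ⊕ z ⊜ k ⊕ ((x ⊕ y) ⊕ z)) refl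

  pull-middle : ∀ k x y z → (x * (k * y)) * z ≈ k * ((x * y) * z)
  pull-middle = ×-Solver.solve 4 (λ k x y z → (x ⊕ (k ⊕ y)) ⊕ z ⊜ k ⊕ ((x ⊕ y) ⊕ z)) refl

  pull-right : ∀ k x y z → (x * y) * (k * z) ≈ k * ((x * y) * z)
  pull-right = ×-Solver.solve 4 (λ k x y z → (x ⊕ y) ⊕ (k ⊕ z) ⊜ k ⊕ ((x ⊕ y) ⊕ z)) refl

  -- Conditioning on whether e₀ ∈ E_p, which happens with probability p₀.
  expect-suc : ∀ {n} (p : Fin (suc n) → Carrier) (g : Subset (suc n) → Carrier) →
    expect p g ≈ (1# - p Fin.zero) * expect (λ i → p (Fin.suc i)) (without₀ g)
                   + p Fin.zero * expect (λ i → p (Fin.suc i)) (with₀ g)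
  expect-suc {n} p g = begin
    expect p g
      ≈⟨ sumL-subsetsOf-inside (⊤ {n}) (λ A → probOf p A * g A) ⟩
    sumL S (λ A → (a A * (u₀ * b A)) * g (outside ∷ A)) + sumL S (λ A → ((p₀ * a A) * b A) * g (inside ∷ A))
      ≈⟨ +-cong (sumL-cong S (λ A → pull-middle u₀ (a A) (b A) _))
                (sumL-cong S (λ A → pull-left p₀ (a A) (b A) _)) ⟩
    sumL S (λ A → u₀ * (probOf p′ A * without₀ g A)) + sumL S (λ A → p₀ * (probOf p′ A * with₀ g A))
      ≈⟨ +-cong (sumL-*ˡ S u₀ _) (sumL-*ˡ S p₀ _) ⟩
    u₀ * expect p′ (without₀ g) + p₀ * expect p′ (with₀ g) ∎
    where
    S : List (Subset n)
    S = allSubsets n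
    p′ : Fin n → Carrier
    p′ i = p (Fin.suc i)
    p₀ u₀ : Carrier
    p₀ = p Fin.zero
    u₀ = 1# - p₀
    a b : Subset n → Carrier
    a A = prodIn A p′
    b A = prodIn (∁ A) (λ e → 1# - p′ e)

  zSum-suc : ∀ {n} (p : Fin (suc n) → Carrier) (f : Subset (suc n) → Carrier) →
    zSum p f ≈ (1# - p Fin.zero) * zSum (λ i → p (Fin.suc i)) (without₀ f)
                 + ((p Fin.zero + p Fin.zero) - 1#) * zSum (λ i → p (Fin.suc i)) (with₀ f)
  zSum-suc {n} p f = begin
    zSum p f
      ≈⟨ sumL-subsetsOf-inside (⊤ {n}) summand ⟩
    sumL S (λ C → f (outside ∷ C) * a C * (u₀ * b C)) + sumL S (λ C → f (inside ∷ C) * (q₀ * a C) * b C)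
      ≈⟨ +-cong (sumL-cong S (λ C → pull-right u₀ _ (a C) (b C)))
                (sumL-cong S (λ C → pull-middle q₀ _ (a C) (b C))) ⟩
    sumL S (λ C → u₀ * (without₀ f C * a C * b C)) + sumL S (λ C → q₀ * (with₀ f C * a C * b C))
      ≈⟨ +-cong (sumL-*ˡ S u₀ _) (sumL-*ˡ S q₀ _) ⟩
    u₀ * zSum p′ (without₀ f) + q₀ * zSum p′ (with₀ f) ∎
    where
    S : List (Subset n)
    S = allSubsets n
    summand : Subset (suc n) → Carrier
    summand C = f C * prodIn C (λ e → (p e + p e) - 1#) * prodIn (∁ C) (λ e → 1# - p e)
    p′ : Fin n → Carrier
    p′ i = p (Fin.suc i)
    p₀ u₀ q₀ : Carrier
    p₀ = p Fin.zero
    u₀ = 1# - p₀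
    q₀ = (p₀ + p₀) - 1#
    a b : Subset n → Carrier
    a C = prodIn C (λ e → (p′ e + p′ e) - 1#)
    b C = prodIn (∁ C) (λ e → 1# - p′ e)

  -- The weights match: p₀ - (1 - p₀) = 2p₀ - 1.
  mix-weights : ∀ a x y → (1# - a) * (x - y) + a * y ≈ (1# - a) * x + ((a + a) - 1#) * y
  mix-weights a x y = begin
    (1# - a) * (x - y) + a * y                ≈⟨ +-congʳ (x[y-z]≈xy-xz (1# - a) x y) ⟩
    ((1# - a) * x - (1# - a) * y) + a * y     ≈⟨ +-assoc _ _ _ ⟩
    (1# - a) * x + (- ((1# - a) * y) + a * y) ≈⟨ +-congˡ (+-comm _ _) ⟩
    (1# - a) * x + (a * y - (1# - a) * y)     ≈⟨ +-congˡ ([y-z]x≈yx-zx y a (1# - a)) ⟨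
    (1# - a) * x + (a - (1# - a)) * y         ≈⟨ +-congˡ (*-congʳ weight) ⟩
    (1# - a) * x + ((a + a) - 1#) * y         ∎
    where
    weight : a - (1# - a) ≈ (a + a) - 1#
    weight = trans (+-congˡ (⁻¹-anti-homo‿- 1# a)) (sym (+-assoc a a (- 1#)))

  expect-contraction : ∀ n (p : Fin n → Carrier) (f : Subset n → Carrier) →
                       expect p (contraction f) ≈ zSum p f
  expect-contraction zero p f = +-congʳ (begin
    (1# * 1#) * (1# * f [] + 0#) ≈⟨ *-cong (*-identityˡ 1#) (+-identityʳ _) ⟩
    1# * (1# * f [])             ≈⟨ trans (*-identityˡ _) (*-identityˡ _) ⟩
    f []                         ≈⟨ trans (*-identityʳ _) (*-identityʳ _) ⟨
    f [] * 1# * 1#               ∎)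
  expect-contraction (suc n) p f = begin
    expect p (contraction f)
      ≈⟨ expect-suc p (contraction f) ⟩
    u₀ * expect p′ (without₀ (contraction f)) + p₀ * expect p′ (with₀ (contraction f))
      ≈⟨ +-cong (*-congˡ (expect-cong p′ (contraction-outside f)))
                (*-congˡ (expect-cong p′ (contraction-inside f))) ⟩
    u₀ * expect p′ (λ A → c₀ A - c₁ A) + p₀ * expect p′ c₁
      ≈⟨ +-congʳ (*-congˡ (expect-sub p′ c₀ c₁)) ⟩
    u₀ * (expect p′ c₀ - expect p′ c₁) + p₀ * expect p′ c₁
      ≈⟨ mix-weights p₀ _ _ ⟩
    u₀ * expect p′ c₀ + q₀ * expect p′ c₁
      ≈⟨ +-cong (*-congˡ (expect-contraction n p′ (without₀ f)))
                (*-congˡ (expect-contraction n p′ (with₀ f))) ⟩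
    u₀ * zSum p′ (without₀ f) + q₀ * zSum p′ (with₀ f)
      ≈⟨ zSum-suc p f ⟨
    zSum p f ∎
    where
    p′ : Fin n → Carrier
    p′ i = p (Fin.suc i)
    p₀ u₀ q₀ : Carrier
    p₀ = p Fin.zero
    u₀ = 1# - p₀
    q₀ = (p₀ + p₀) - 1#
    c₀ c₁ : Subset n → Carrier
    c₀ = contraction (without₀ f)
    c₁ = contraction (with₀ f)

-- Corollary 3.31: apply the main identity to f(A) = m(A) s^{r(Γ) - r(A)}.
corollary3p31 : ∀ {c ℓ c′ ℓ′} (Γ : AbelianGroup c ℓ) → GroupRank.FinitelyGenerated Γ →
    ∀ (n : ℕ) (E : Vec (AbelianGroup.Carrier Γ) n)
    (r : Subset n → ℕ) → (∀ A → GroupRank.HasRank Γ (GroupRank.InSpan Γ E A) (r A)) →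
    ∀ (rΓ : ℕ) → GroupRank.HasRank Γ (λ _ → Data.Unit.Polymorphic.⊤ {ℓ = Level.zero}) rΓ →
    ∀ (R : CommutativeRing c′ ℓ′) (m : Subset n → CommutativeRing.Carrier R)
    (p : Fin n → CommutativeRing.Carrier R) (s : CommutativeRing.Carrier R) →
    CommutativeRing._≈_ R
    (RingOps.expect R p (RingOps.chiContr R r rΓ m s))
    (RingOps.rhsZ R r rΓ m p s)
corollary3p31 _ _ n _ r _ rΓ _ R m p s =
  trans (expect-cong p χ≈contraction) (expect-contraction n p f)
  where
  open CommutativeRing R
  open RingOps R
  open SubsetExpectation R
  f : Subset n → Carrier
  f A = m A * pow s (rΓ ∸ r A)
  -- χ_{M/A}(s) is the contraction of f, up to reassociating each summand.
  χ≈contraction : ∀ A → chiContr r rΓ m s A ≈ contraction f A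
  χ≈contraction A = sumL-cong (subsetsOf (∁ A)) (λ B → *-assoc _ _ _)
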